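{- Let $M$ be a fair Kripke structure with set of state variables $V$, and let $V_i\subseteq V$ be the set of transition input variables of $M$ that are irrelevant for fairness. Let $M_{L2S}$ be the liveness-to-safety transformation of $M$, and let $\widetilde{M}_{L2S}$ be the variant of $M_{L2S}$ in which loop detection (the copying of the current state into $\hat v$ and the equality check $v=\hat v$) is restricted to the variables in $V\setminus V_i$. Then there is a reachable state $\tilde{s}$ of $M_{L2S}$ with $\mathit{LoopClosed}(\tilde{s})$ true if and only if there is such a reachable state of $\widetilde{M}_{L2S}$.
   Context: A fair Kripke structure $M=(S,T,I,L,F=\{F_0,\dots,F_f\})$ is given symbolically over a finite set of state variables $V=\{v_0,v_1,\dots\}$: states are (possibly constrained) valuations $(x_0,x_1,\ldots)$, $T\subseteq S\times S$ total, $I\subseteq S$, $F_m\subseteq S$. A state variable $v_i$ is a transition input variable iff whenever $((x_0,\ldots,x_i,\ldots),(x_0',\ldots,x_i',\ldots))\in T$, then for every $\tilde x_i'$ in the range of $v_i$ also $((x_0,\ldots,x_i,\ldots),(x_0',\ldots,\tilde x_i',\ldots))\in T$. A state variable $v_i$ is irrelevant for fairness iff for every acceptance set $F_m$, $(x_0,\ldots,x_i,\ldots)\in F_m$ iff $(x_0,\ldots,\tilde x_i,\ldots)\in F_m$ for all $\tilde x_i$ in the range of $v_i$. The transformation $M_{L2S}$: state variables are those of $M$ (collectively $v$), a copy $\hat v$ of them, and Booleans $l_s,\mathit{InLoop},\mathit{LoopClosed},Acc_m$ ($0\le m\le f$); its states, initial states and transitions are the largest sets satisfying: (states) $v$ is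 a state of $M$, $\mathit{LoopClosed}\Rightarrow\mathit{InLoop}$, $\mathit{LoopClosed}\Rightarrow v=\hat v$, $\mathit{LoopClosed}\Rightarrow Acc_m$ for all $m$; (initial) $v\in I$, $l_s=\mathit{InLoop}=\bot$, $Acc_m=\bot$; (transitions, primes for next state) $(v,v')\in T$, $\mathit{InLoop}'\Leftrightarrow\mathit{InLoop}\vee l_s'$, $\mathit{InLoop}\Rightarrow\neg l_s'$, $(l_s'\Rightarrow\hat v'=v)\wedge(\neg l_s'\Rightarrow\hat v'=\hat v)$, $Acc_m'\Leftrightarrow Acc_m\vee(\mathit{InLoop}'\wedge v'\in F_m)$. In $\widetilde M_{L2S}$, $\hat v$ holds copies only of the variables in $V\setminus V_i$, and the constraints $(l_s'\Rightarrow\hat v'=v)\wedge(\neg l_s'\Rightarrow\hat v'=\hat v)$ and $\mathit{LoopClosed}\Rightarrow v=\hat v$ are imposed only on the variables in $V\setminus V_i$. A state is reachable if it ends a finite path starting in an initial state. -}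

module Defs where

open import Data.Nat using (ℕ; suc)
open import Data.Fin using (Fin)
open import Data.Bool using (Bool; true; false; not; _∨_) renaming (T to IsTrue)
open import Data.Product using (Σ; ∃; _×_)
open import Data.Sum using (_⊎_)
open import Relation.Nullary using (¬_)
open import Relation.Binary.PropositionalEquality using (_≡_; _≢_)
open import Function.Bundles using (_⇔_)

record FKS (n f : ℕ) : Set₁ where
  field
    Range : Fin n → Set
  Val : Set
  Val = (j : Fin n) → Range j
  field
    State   : Val → Set
    Trans   : Val → Val → Set
    Init    : Val → Set
    Fair    : Fin (suc f) → Val → Set
    T⊆S×S   : ∀ x y → Trans x y → State x × State y
    I⊆S     : ∀ x → Init x → State x
    F⊆S     : ∀ m x → Fair m x → State x
    T-total : ∀ x → State x → ∃ λ y → Trans x y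

module _ {n f : ℕ} (M : FKS n f) where
  open FKS M

  AgreeExcept : Fin n → Val → Val → Set
  AgreeExcept i x y = ∀ j → j ≢ i → x j ≡ y j

  -- v_i is a transition input variable: replacing the value of v_i in the
  -- successor by any value of its range (i.e. any valuation agreeing with the
  -- successor off v_i) yields again a transition.
  TransitionInput : Fin n → Set
  TransitionInput i = ∀ x x' x'' → Trans x x' → AgreeExcept i x' x'' → Trans x x''

  IrrelevantForFairness : Fin n → Set
  IrrelevantForFairness i =
    ∀ m x x̃ → AgreeExcept i x x̃ → (Fair m x → Fair m x̃) × (Fair m x̃ → Fair m x)

  -- Generic liveness-to-safety construction, where the copy v̂ holds copies
  -- exactly of the variables j with tracked j ≡ true, and loop detection
  -- (copying and equality check) is performed only on those variables.
  -- M_L2S is the instance tracked = λ _ → true;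
  -- M̃_L2S is the instance tracked = not ∘ (membership in V_i).
  module L2S (tracked : Fin n → Bool) where

    Hat : Set
    Hat = (j : Fin n) → IsTrue (tracked j) → Range j

    record St : Set where
      constructor mkSt
      field
        v          : Val
        v̂          : Hat
        ls         : Bool
        InLoop     : Bool
        LoopClosed : Bool
        Acc        : Fin (suc f) → Bool

    open St public

    IsState : St → Set
    IsState s =
      State (v s) ×
      (LoopClosed s ≡ true → InLoop s ≡ true) ×
      (LoopClosed s ≡ true → ∀ j (t : IsTrue (tracked j)) → v s j ≡ v̂ s j t) ×
      (LoopClosed s ≡ true → ∀ m → Acc s m ≡ true)

    IsInit : St → Set
    IsInit s =
      IsState s × Init (v s) × ls s ≡ false × InLoop s ≡ false ×
      (∀ m → Acc s m ≡ false)

    IsTrans : St → St → Set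
    IsTrans s s' =
      IsState s × IsState s' ×
      Trans (v s) (v s') ×
      InLoop s' ≡ (InLoop s ∨ ls s') ×
      (InLoop s ≡ true → ls s' ≡ false) ×
      (ls s' ≡ true → ∀ j (t : IsTrue (tracked j)) → v̂ s' j t ≡ v s j) ×
      (ls s' ≡ false → ∀ j (t : IsTrue (tracked j)) → v̂ s' j t ≡ v̂ s j t) ×
      (∀ m → (Acc s' m ≡ true → (Acc s m ≡ true ⊎ (InLoop s' ≡ true × Fair m (v s'))))
           × ((Acc s m ≡ true ⊎ (InLoop s' ≡ true × Fair m (v s'))) → Acc s' m ≡ true))

    data Reachable : St → Set where
      init : ∀ {s} → IsInit s → Reachable s
      step : ∀ {s s'} → Reachable s → IsTrans s s' → Reachable s'

    LoopClosedReachable : Set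
    LoopClosedReachable = ∃ λ s → Reachable s × LoopClosed s ≡ true

  L2S-full : Set
  L2S-full = L2S.LoopClosedReachable (λ _ → true)

  -- M̃_L2S: copies only of the variables outside V_i (Vi j ≡ true means j ∈ V_i)
  L2S-tilde : (Fin n → Bool) → Set
  L2S-tilde Vi = L2S.LoopClosedReachable (λ j → not (Vi j))

  IsVi : (Fin n → Bool) → Set
  IsVi Vi = ∀ j → (Vi j ≡ true → TransitionInput j × IrrelevantForFairness j)
                × (TransitionInput j × IrrelevantForFairness j → Vi j ≡ true)

{-# OPTIONS --safe #-}
-- Forgetting the copies of some variables turns every run of M_L2S into a run
-- of M̃_L2S. Conversely, M_L2S can shadow a run of M̃_L2S with LoopClosed kept
-- false, choosing its copy v̂ to agree with that of M̃_L2S on the tracked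
-- variables. When M̃_L2S closes its loop, M_L2S takes the same step but
-- overwrites the untracked variables of the successor by their copies in v̂:
-- they are transition inputs, so this is still a transition, and irrelevant
-- for fairness, so the Acc bits are unaffected; now v = v̂ holds everywhere.
module Submission where

open import Defs
open import Data.Nat using (ℕ)
open import Data.Fin using (Fin; _≟_)
open import Data.Bool using (Bool; true; false; not) renaming (T to IsTrue)
open import Data.Bool.Properties using (T?; T-not-≡; ¬-not)
open import Data.Unit using (tt)
open import Data.Product using (Σ; _×_; _,_; proj₁; proj₂)
import Data.Sum as Sum
import Data.Product as Product
open import Data.List using (List; []; _∷_; allFin; filter)
open import Data.List.Relation.Unary.Any using (here; there)
open import Data.List.Membership.Propositional using (_∈_; _∉_)
open import Data.List.Membership.Propositional.Properties using (∈-allFin; ∈-filter⁺; ∈-filter⁻)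
open import Relation.Nullary using (¬_; yes; no; ¬?; contradiction)
open import Relation.Binary.PropositionalEquality using (_≡_; _≢_; refl; sym; trans)
open import Function using (_∘_)
open import Function.Bundles using (_⇔_; mk⇔; module Equivalence)
open import Function.Construct.Identity using (⇔-id)
open import Function.Construct.Composition using (_⇔-∘_)

module Valuations {n f : ℕ} (M : FKS n f) where
  open FKS M

  Stable : (Val → Set) → Fin n → Set
  Stable P i = ∀ {x y} → AgreeExcept M i x y → P x → P y

  update : Val → (i : Fin n) → Range i → Val
  update x i a j with i ≟ j
  ... | yes refl = a
  ... | no _     = x j

  update-≡ : ∀ x i a → update x i a i ≡ a
  update-≡ x i a with i ≟ i
  ... | yes refl = refl
  ... | no i≢i   = contradiction refl i≢i

  update-≢ : ∀ x {i} a {j} → i ≢ j → update x i a j ≡ x j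
  update-≢ x {i} a {j} i≢j with i ≟ j
  ... | yes i≡j = contradiction i≡j i≢j
  ... | no _    = refl

  update-agreeExcept : ∀ x i a → AgreeExcept M i x (update x i a)
  update-agreeExcept x i a j j≢i = sym (update-≢ x a (j≢i ∘ sym))

  overwrite : List (Fin n) → Val → Val → Val
  overwrite []       y x = x
  overwrite (i ∷ is) y x = update (overwrite is y x) i (y i)

  overwrite-∈ : ∀ is y x {j} → j ∈ is → overwrite is y x j ≡ y j
  overwrite-∈ (i ∷ is) y x (here refl) = update-≡ (overwrite is y x) i (y i)
  overwrite-∈ (i ∷ is) y x {j} (there j∈is) with i ≟ j
  ... | yes refl = refl
  ... | no _     = overwrite-∈ is y x j∈is

  overwrite-∉ : ∀ is y x {j} → j ∉ is → overwrite is y x j ≡ x j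
  overwrite-∉ []       y x j∉is = refl
  overwrite-∉ (i ∷ is) y x j∉is =
    trans (update-≢ (overwrite is y x) (y i) (λ i≡j → j∉is (here (sym i≡j))))
          (overwrite-∉ is y x (j∉is ∘ there))

  overwrite-stable : ∀ {P} is → (∀ {i} → i ∈ is → Stable P i) →
                     ∀ y {x} → P x → P (overwrite is y x)
  overwrite-stable []       stable y Px = Px
  overwrite-stable (i ∷ is) stable y Px =
    stable (here refl) (update-agreeExcept _ i (y i))
           (overwrite-stable is (stable ∘ there) y Px)

module Restrict {n f : ℕ} (M : FKS n f) (t t' : Fin n → Bool)
                (t⊆t' : ∀ j → IsTrue (t j) → IsTrue (t' j)) where
  module Big   = L2S M t'
  module Small = L2S M t

  forget : Big.St → Small.St
  forget s = Small.mkSt (Big.v s) (λ j p → Big.v̂ s j (t⊆t' j p))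
                        (Big.ls s) (Big.InLoop s) (Big.LoopClosed s) (Big.Acc s)

  forget-isState : ∀ s → Big.IsState s → Small.IsState (forget s)
  forget-isState s (st , closed⇒inLoop , closed⇒v≡v̂ , closed⇒acc) =
    st , closed⇒inLoop , (λ lc j p → closed⇒v≡v̂ lc j (t⊆t' j p)) , closed⇒acc

  forget-isInit : ∀ s → Big.IsInit s → Small.IsInit (forget s)
  forget-isInit s (st , rest) = forget-isState s st , rest

  forget-isTrans : ∀ s s' → Big.IsTrans s s' → Small.IsTrans (forget s) (forget s')
  forget-isTrans s s' (st , st' , tr , inLoop , noRestart , copy , keep , acc) =
    forget-isState s st , forget-isState s' st' , tr , inLoop , noRestart ,
    (λ e j p → copy e j (t⊆t' j p)) , (λ e j p → keep e j (t⊆t' j p)) , acc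

  forget-reachable : ∀ {s} → Big.Reachable s → Small.Reachable (forget s)
  forget-reachable (Big.init {s} i)         = Small.init (forget-isInit s i)
  forget-reachable (Big.step {s} {s'} r tr) =
    Small.step (forget-reachable r) (forget-isTrans s s' tr)

  loopClosed-restrict : Big.LoopClosedReachable → Small.LoopClosedReachable
  loopClosed-restrict (s , r , lc) = forget s , forget-reachable r , lc

module TrackAll {n f : ℕ} (M : FKS n f) (t : Fin n → Bool)
                (untracked⇒input×irrelevant : ∀ j → ¬ IsTrue (t j) →
                                  TransitionInput M j × IrrelevantForFairness M j) where
  open FKS M
  open Valuations M
  module Full  = L2S M (λ _ → true)
  module Tilde = L2S M t

  Related : Full.Hat → Tilde.Hat → Set
  Related h ĥ = ∀ j p → h j tt ≡ ĥ j p

  extendHat : Val → Tilde.Hat → Full.Hat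
  extendHat x ĥ j _ with t j | ĥ j
  ... | true  | ĥj = ĥj tt
  ... | false | _  = x j

  extendHat-related : ∀ x ĥ → Related (extendHat x ĥ) ĥ
  extendHat-related x ĥ j p with t j | ĥ j
  ... | true | ĥj = refl

  hatAfter : Bool → Val → Full.Hat → Full.Hat
  hatAfter true  x h j _ = x j
  hatAfter false x h     = h

  hatAfter-true : ∀ {b} x h → b ≡ true → ∀ j p → hatAfter b x h j p ≡ x j
  hatAfter-true x h refl j p = refl

  hatAfter-false : ∀ {b} x h → b ≡ false → ∀ j p → hatAfter b x h j p ≡ h j p
  hatAfter-false x h refl j p = refl

  hatAfter-related : ∀ b {x h ĥ ĥ'} →
                     (b ≡ true → ∀ j p → ĥ' j p ≡ x j) →
                     (b ≡ false → ∀ j p → ĥ' j p ≡ ĥ j p) →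
                     Related h ĥ → Related (hatAfter b x h) ĥ'
  hatAfter-related true  copy keep rel j p = sym (copy refl j p)
  hatAfter-related false copy keep rel j p = trans (rel j p) (sym (keep refl j p))

  nextHat : Tilde.St → Tilde.St → Full.Hat → Full.Hat
  nextHat s₀ s = hatAfter (Tilde.ls s) (Tilde.v s₀)

  nextHat-related : ∀ s₀ s h₀ → Tilde.IsTrans s₀ s → Related h₀ (Tilde.v̂ s₀) →
                    Related (nextHat s₀ s h₀) (Tilde.v̂ s)
  nextHat-related s₀ s h₀ (_ , _ , _ , _ , _ , copy , keep , _) =
    hatAfter-related (Tilde.ls s) copy keep

  lift : Tilde.St → Full.Hat → Val → Bool → Full.St
  lift s h x lc = Full.mkSt x h (Tilde.ls s) (Tilde.InLoop s) lc (Tilde.Acc s)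

  embed : Tilde.St → Full.Hat → Full.St
  embed s h = lift s h (Tilde.v s) false

  embed-isState : ∀ s h → Tilde.IsState s → Full.IsState (embed s h)
  embed-isState s h (st , _) = st , (λ ()) , (λ ()) , (λ ())

  lift-isTrans : ∀ s₀ s h₀ x lc → Tilde.IsTrans s₀ s →
                 Full.IsState (lift s (nextHat s₀ s h₀) x lc) →
                 Trans (Tilde.v s₀) x →
                 (∀ m → Fair m (Tilde.v s) ⇔ Fair m x) →
                 Full.IsTrans (embed s₀ h₀) (lift s (nextHat s₀ s h₀) x lc)
  lift-isTrans s₀ s h₀ x lc (st₀ , _ , _ , inLoop , noRestart , _ , _ , acc) st' tr fair =
    embed-isState s₀ h₀ st₀ , st' , tr , inLoop , noRestart ,
    hatAfter-true (Tilde.v s₀) h₀ , hatAfter-false (Tilde.v s₀) h₀ ,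
    λ m → Sum.map₂ (Product.map₂ (Equivalence.to (fair m))) ∘ proj₁ (acc m)
        , proj₂ (acc m) ∘ Sum.map₂ (Product.map₂ (Equivalence.from (fair m)))

  embed-isTrans : ∀ s₀ s h₀ → Tilde.IsTrans s₀ s →
                  Full.IsTrans (embed s₀ h₀) (embed s (nextHat s₀ s h₀))
  embed-isTrans s₀ s h₀ tr@(_ , st , v-tr , _) =
    lift-isTrans s₀ s h₀ _ false tr (embed-isState s _ st) v-tr (λ m → ⇔-id _)

  simulate : ∀ {s} → Tilde.Reachable s →
             Σ Full.Hat λ h → Full.Reachable (embed s h) × Related h (Tilde.v̂ s)
  simulate (Tilde.init {s} (st , rest)) =
    extendHat (Tilde.v s) (Tilde.v̂ s) ,
    Full.init (embed-isState s _ st , rest) ,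
    extendHat-related (Tilde.v s) (Tilde.v̂ s)
  simulate (Tilde.step {s₀} {s} r tr) with simulate r
  ... | h₀ , r₀ , rel =
    nextHat s₀ s h₀ , Full.step r₀ (embed-isTrans s₀ s h₀ tr) , nextHat-related s₀ s h₀ tr rel

  untracked : List (Fin n)
  untracked = filter (λ j → ¬? (T? (t j))) (allFin n)

  untracked-∈⁻ : ∀ {j} → j ∈ untracked → ¬ IsTrue (t j)
  untracked-∈⁻ j∈ = proj₂ (∈-filter⁻ (λ j → ¬? (T? (t j))) {xs = allFin n} j∈)

  untracked-∈⁺ : ∀ {j} → ¬ IsTrue (t j) → j ∈ untracked
  untracked-∈⁺ {j} = ∈-filter⁺ (λ j → ¬? (T? (t j))) (∈-allFin j)

  untracked-stable : ∀ {P} → (∀ j → ¬ IsTrue (t j) → Stable P j) →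
                     ∀ {i} → i ∈ untracked → Stable P i
  untracked-stable stable {i} i∈ = stable i (untracked-∈⁻ i∈)

  closeLoop : Full.Hat → Val → Val
  closeLoop h = overwrite untracked (λ j → h j tt)

  closeLoop-tracked : ∀ h x j → IsTrue (t j) → closeLoop h x j ≡ x j
  closeLoop-tracked h x j p = overwrite-∉ untracked _ x (λ j∈ → untracked-∈⁻ j∈ p)

  closeLoop-untracked : ∀ h x j → ¬ IsTrue (t j) → closeLoop h x j ≡ h j tt
  closeLoop-untracked h x j ¬p = overwrite-∈ untracked _ x (untracked-∈⁺ ¬p)

  closeLoop-closes : ∀ {h ĥ x} → Related h ĥ → (∀ j p → x j ≡ ĥ j p) →
                     ∀ j → closeLoop h x j ≡ h j tt
  closeLoop-closes {h} {ĥ} {x} rel x≡ĥ j with T? (t j)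
  ... | yes p = trans (closeLoop-tracked h x j p) (trans (x≡ĥ j p) (sym (rel j p)))
  ... | no ¬p = closeLoop-untracked h x j ¬p

  closeLoop-trans : ∀ h {x x'} → Trans x x' → Trans x (closeLoop h x')
  closeLoop-trans h {x} =
    overwrite-stable untracked (untracked-stable input) (λ j → h j tt)
    where
    input : ∀ j → ¬ IsTrue (t j) → Stable (Trans x) j
    input j ¬p agree tr = proj₁ (untracked⇒input×irrelevant j ¬p) x _ _ tr agree

  closeLoop-fair : ∀ h m x → Fair m x ⇔ Fair m (closeLoop h x)
  closeLoop-fair h m x =
    overwrite-stable untracked (untracked-stable irrelevant) (λ j → h j tt) (⇔-id _)
    where
    irrelevant : ∀ j → ¬ IsTrue (t j) → Stable (λ z → Fair m x ⇔ Fair m z) j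
    irrelevant j ¬p agree x⇔y =
      Product.uncurry mk⇔ (proj₂ (untracked⇒input×irrelevant j ¬p) m _ _ agree) ⇔-∘ x⇔y

  closed : Tilde.St → Full.Hat → Full.St
  closed s h = lift s h (closeLoop h (Tilde.v s)) true

  closed-isState : ∀ s h → Tilde.IsState s → Tilde.LoopClosed s ≡ true →
                   Related h (Tilde.v̂ s) → State (closeLoop h (Tilde.v s)) →
                   Full.IsState (closed s h)
  closed-isState s h (_ , closed⇒inLoop , closed⇒v≡v̂ , closed⇒acc) lc rel st =
    st , (λ _ → closed⇒inLoop lc) , (λ _ j _ → closeLoop-closes rel (closed⇒v≡v̂ lc) j) ,
    (λ _ → closed⇒acc lc)

  closed-isTrans : ∀ s₀ s h₀ → Tilde.IsTrans s₀ s → Tilde.LoopClosed s ≡ true →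
                   Related h₀ (Tilde.v̂ s₀) →
                   Full.IsTrans (embed s₀ h₀) (closed s (nextHat s₀ s h₀))
  closed-isTrans s₀ s h₀ tr@(_ , st , v-tr , _) lc rel =
    lift-isTrans s₀ s h₀ _ true tr
      (closed-isState s h st lc (nextHat-related s₀ s h₀ tr rel) (proj₂ (T⊆S×S _ _ closed-tr)))
      closed-tr (λ m → closeLoop-fair h m (Tilde.v s))
    where
    h : Full.Hat
    h = nextHat s₀ s h₀
    closed-tr : Trans (Tilde.v s₀) (closeLoop h (Tilde.v s))
    closed-tr = closeLoop-trans h v-tr

  loopClosed-trackAll : Tilde.LoopClosedReachable → Full.LoopClosedReachable
  loopClosed-trackAll (s , Tilde.init ((_ , closed⇒inLoop , _) , _ , _ , notInLoop , _) , lc)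
    with trans (sym notInLoop) (closed⇒inLoop lc)
  ... | ()
  loopClosed-trackAll (s , Tilde.step {s₀} r tr , lc) with simulate r
  ... | h₀ , r₀ , rel =
    closed s (nextHat s₀ s h₀) , Full.step r₀ (closed-isTrans s₀ s h₀ tr lc rel) , refl

proposition4p3 : {n f : ℕ} (M : FKS n f) (Vi : Fin n → Bool) →
    IsVi M Vi → L2S-full M ⇔ L2S-tilde M Vi
proposition4p3 M Vi isVi =
  mk⇔ (Restrict.loopClosed-restrict M (not ∘ Vi) (λ _ → true) (λ _ _ → tt))
      (TrackAll.loopClosed-trackAll M (not ∘ Vi) untracked⇒input×irrelevant)
  where
  untracked⇒input×irrelevant : ∀ j → ¬ IsTrue (not (Vi j)) →
                               TransitionInput M j × IrrelevantForFairness M j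
  untracked⇒input×irrelevant j ¬p = proj₁ (isVi j) (¬-not (¬p ∘ Equivalence.from T-not-≡))
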